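{- Let $P$ be an odd prime and let $A\le B\le C$ be positive integers with $\frac4P=\frac1A+\frac1B+\frac1C$. If exactly one of $A,B,C$ is divisible by $P$, then that denominator is $C$, i.e.\ $C=cP$ for some $c\in\mathbb{N}$. -}

module Defs where

open import Data.Nat using (ℕ)
open import Data.Nat.Divisibility using (_∣_)
open import Data.Product using (_×_)
open import Data.Sum using (_⊎_)
open import Relation.Nullary using (¬_)

ExactlyOneDivisible : ℕ → ℕ → ℕ → ℕ → Set
ExactlyOneDivisible p a b c =
    (p ∣ a × ¬ (p ∣ b) × ¬ (p ∣ c))
  ⊎ (¬ (p ∣ a) × p ∣ b × ¬ (p ∣ c))
  ⊎ (¬ (p ∣ a) × ¬ (p ∣ b) × p ∣ c)

{-# OPTIONS --safe #-}
-- Since 4/P = 1/A + 1/B + 1/C ≤ 3/A, we have 4A ≤ 3P, so A < P and P cannot divide A.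
-- If P divided B = bP but not C, clearing P from the equation gives C·D = A·B with
-- D = 4Ab − A − B.  As P ∣ A·B and P ∤ C, Euclid's lemma gives P ∣ D, while B ≤ C forces
-- 0 < D ≤ A; hence P ≤ A, a contradiction.
module Submission where

open import Defs
open import Data.Nat using (ℕ; _+_; _*_; _≤_; _<_; _%_; _∸_; NonZero; >-nonZero)
open import Data.Nat.Properties
open import Data.Nat.Primality using (Prime; euclidsLemma; prime⇒nonZero)
open import Data.Nat.Divisibility using (_∣_; _∤_; divides; ∣⇒≤; ∣n⇒∣m*n)
open import Data.Nat.Solver using (module +-*-Solver)
open import Data.Product using (∃-syntax; _,_)
open import Data.Sum using (inj₁; inj₂)
open import Relation.Nullary using (contradiction)
open import Relation.Binary.PropositionalEquality
open +-*-Solver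

least-denominator-bound : ∀ k p a b c .{{_ : NonZero (b * c)}} → a ≤ b → b ≤ c →
  k * (a * b * c) ≡ p * (b * c + a * c + a * b) → k * a ≤ 3 * p
least-denominator-bound k p a b c a≤b b≤c eq = *-cancelʳ-≤ (k * a) (3 * p) (b * c) (begin
  k * a * (b * c)               ≡⟨ solve 4 (λ k a b c → k :* a :* (b :* c) := k :* (a :* b :* c)) refl k a b c ⟩
  k * (a * b * c)               ≡⟨ eq ⟩
  p * (b * c + a * c + a * b)   ≤⟨ *-monoʳ-≤ p (+-mono-≤ (+-monoʳ-≤ (b * c) ac≤bc) ab≤bc) ⟩
  p * (b * c + b * c + b * c)   ≡⟨ solve 3 (λ p b c → p :* (b :* c :+ b :* c :+ b :* c) := con 3 :* p :* (b :* c)) refl p b c ⟩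
  3 * p * (b * c)               ∎)
  where
  open ≤-Reasoning
  ac≤bc : a * c ≤ b * c
  ac≤bc = *-monoˡ-≤ c a≤b
  ab≤bc : a * b ≤ b * c
  ab≤bc = ≤-trans (*-monoʳ-≤ a b≤c) ac≤bc

least-denominator-below : ∀ k p a b c .{{_ : NonZero p}} → 3 < k → 0 < b → a ≤ b → b ≤ c →
  k * (a * b * c) ≡ p * (b * c + a * c + a * b) → a < p
least-denominator-below k p a b c 3<k 0<b a≤b b≤c eq = *-cancelˡ-< k a p (begin-strict
  k * a   ≤⟨ least-denominator-bound k p a b c {{bc≢0}} a≤b b≤c eq ⟩
  3 * p   <⟨ *-monoˡ-< p 3<k ⟩
  k * p   ∎)
  where
  open ≤-Reasoning
  bc≢0 : NonZero (b * c)
  bc≢0 = >-nonZero (*-mono-< 0<b (<-≤-trans 0<b b≤c))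

c*x≡c*y+z⇒c*[x∸y]≡z : ∀ c x y z → c * x ≡ c * y + z → c * (x ∸ y) ≡ z
c*x≡c*y+z⇒c*[x∸y]≡z c x y z eq = begin
  c * (x ∸ y)         ≡⟨ *-distribˡ-∸ c x y ⟩
  c * x ∸ c * y       ≡⟨ cong (_∸ c * y) eq ⟩
  c * y + z ∸ c * y   ≡⟨ m+n∸m≡n (c * y) z ⟩
  z                   ∎
  where open ≡-Reasoning

multiple-middle-denominator : ∀ k p a b c q .{{_ : NonZero p}} → b ≡ q * p →
  k * (a * b * c) ≡ p * (b * c + a * c + a * b) → c * (k * a * q ∸ (a + b)) ≡ a * b
multiple-middle-denominator k p a b c q refl eq =
  c*x≡c*y+z⇒c*[x∸y]≡z c (k * a * q) (a + b) (a * b) (*-cancelˡ-≡ _ _ p (begin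
    p * (c * (k * a * q))           ≡⟨ solve 5 (λ k p a q c → p :* (c :* (k :* a :* q))
                                                     := k :* (a :* (q :* p) :* c)) refl k p a q c ⟩
    k * (a * b * c)                 ≡⟨ eq ⟩
    p * (b * c + a * c + a * b)     ≡⟨ solve 4 (λ p a b c → p :* (b :* c :+ a :* c :+ a :* b)
                                                     := p :* (c :* (a :+ b) :+ a :* b)) refl p a b c ⟩
    p * (c * (a + b) + a * b)       ∎))
  where open ≡-Reasoning

c*d≡a*b⇒d≤a : ∀ {a b c d} .{{_ : NonZero c}} → c * d ≡ a * b → b ≤ c → d ≤ a
c*d≡a*b⇒d≤a {a} {b} {c} {d} eq b≤c = *-cancelˡ-≤ c (begin
  c * d   ≡⟨ eq ⟩
  a * b   ≤⟨ *-monoʳ-≤ a b≤c ⟩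
  a * c   ≡⟨ *-comm a c ⟩
  c * a   ∎)
  where open ≤-Reasoning

prime-c*d≡a*b⇒p≤a : ∀ {p a b c d} → Prime p → p ∤ c → p ∣ b → 0 < a * b →
  c * d ≡ a * b → b ≤ c → p ≤ a
prime-c*d≡a*b⇒p≤a {p} {a} {c = c} {d} pr p∤c p∣b 0<ab eq b≤c = ≤-trans (∣⇒≤ p∣d) d≤a
  where
  instance
    cd≢0 : NonZero (c * d)
    cd≢0 = >-nonZero (subst (0 <_) (sym eq) 0<ab)
    c≢0 : NonZero c
    c≢0 = m*n≢0⇒m≢0 c
    d≢0 : NonZero d
    d≢0 = m*n≢0⇒n≢0 c
  d≤a : d ≤ a
  d≤a = c*d≡a*b⇒d≤a eq b≤c
  p∣d : p ∣ d
  p∣d with euclidsLemma c d pr (subst (p ∣_) (sym eq) (∣n⇒∣m*n a p∣b))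
  ... | inj₁ p∣c = contradiction p∣c p∤c
  ... | inj₂ p∣d = p∣d

lemma8p3 : (P A B C : ℕ) → Prime P → P % 2 ≡ 1 → 0 < A → A ≤ B → B ≤ C →
    4 * (A * B * C) ≡ P * (B * C + A * C + A * B) →
    ExactlyOneDivisible P A B C →
    ∃[ c ] C ≡ c * P
lemma8p3 P A B C pr _ 0<A A≤B B≤C eq = denominatorC
  where
  instance
    P≢0 : NonZero P
    P≢0 = prime⇒nonZero pr
  0<B : 0 < B
  0<B = <-≤-trans 0<A A≤B
  A<P : A < P
  A<P = least-denominator-below 4 P A B C ≤-refl 0<B A≤B B≤C eq
  denominatorC : ExactlyOneDivisible P A B C → ∃[ c ] C ≡ c * P
  denominatorC (inj₁ (P∣A , _)) = contradiction (∣⇒≤ {{>-nonZero 0<A}} P∣A) (<⇒≱ A<P)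
  denominatorC (inj₂ (inj₁ (_ , P∣B@(divides b B≡bP) , P∤C))) =
    contradiction (prime-c*d≡a*b⇒p≤a pr P∤C P∣B (*-mono-< 0<A 0<B)
                     (multiple-middle-denominator 4 P A B C b B≡bP eq) B≤C)
                  (<⇒≱ A<P)
  denominatorC (inj₂ (inj₂ (_ , _ , divides c C≡cP))) = c , C≡cP
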